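{- Let $x_1 \ge x_2 \ge \cdots \ge x_n$ be integers and $q \ge 1$ an integer such that for some subset $S \subset [n]$ of size $2q$, all $x_i$ with $i \in S$ are equal. Suppose that for $q$ of the indices $i \in S$ we increase $x_i$ by $1$ and for the other $q$ indices $i \in S$ we decrease $x_i$ by $1$. Then $\Phi = \sum_{i=1}^n x_i^2$ increases by exactly $2q$, and $\Psi = n \sum_i |x_i| + \sum_{i<j} |x_i - x_j|$ increases by at least $2q^2$. -}

module Defs where

open import Data.Nat as ℕ using (ℕ)
open import Data.Integer as ℤ using (ℤ; +_; _+_; _-_; _*_; ∣_∣)
open import Data.Fin using (Fin; _<_)
open import Data.Fin.Subset using (Subset; Side; inside; outside)
open import Data.Vec using (lookup)
open import Data.List using (List; allFin; map; foldr; filter; concatMap)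
open import Data.Product using (_×_; _,_)
open import Data.Fin.Properties using (_<?_)
open import Relation.Nullary using (yes; no)

Σℤ : ∀ {n} → (Fin n → ℤ) → ℤ
Σℤ {n} f = foldr _+_ (+ 0) (map f (allFin n))

Σpairs : ∀ {n} → (Fin n → Fin n → ℤ) → ℤ
Σpairs {n} f = Σℤ (λ i → Σℤ (λ j → g i j))
  where
  g : Fin n → Fin n → ℤ
  g i j with i <? j
  ... | yes _ = f i j
  ... | no _ = + 0

Φ : ∀ {n} → (Fin n → ℤ) → ℤ
Φ x = Σℤ (λ i → x i * x i)

Ψ : ∀ {n} → (Fin n → ℤ) → ℤ
Ψ {n} x = (+ n) * Σℤ (λ i → + ∣ x i ∣) + Σpairs (λ i j → + ∣ x i - x j ∣)

shift : ∀ {n} → (S P : Subset n) → (Fin n → ℤ) → Fin n → ℤ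
shift S P x i with lookup S i | lookup P i
... | inside  | inside  = x i + + 1
... | inside  | outside = x i - + 1
... | outside | _       = x i

{-# OPTIONS --safe #-}
-- Write shift S P x = x + δ, where δ is +1 on P, -1 on S ∖ P and 0 elsewhere, and let c be
-- the common value of x on S, χ = δ² the indicator of S and σᵢ = sgn (xᵢ - c).  Then
-- (xᵢ + δᵢ)² = xᵢ² + 2cδᵢ + χᵢ, and Σ δ = 0, Σ χ = 2q give the change of Φ.  For Ψ, the
-- subgradient inequality of |·| gives |xᵢ + δᵢ| ≥ |xᵢ| + sgn(c) δᵢ, whose corrections cancel,
-- and |yᵢ - yⱼ| ≥ |xᵢ - xⱼ| + gᵢⱼ with gᵢⱼ = χᵢχⱼ - δᵢδⱼ - σᵢδⱼ - δᵢσⱼ.  The gain g is a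
-- symmetric bilinear expression vanishing on the diagonal, so its sum over pairs i < j is half
-- of (Σχ)² - (Σδ)² - 2 Σσ Σδ = 4q².
module Submission where

open import Defs
open import Data.Nat using (ℕ; _≥_)
open import Data.Integer using (ℤ; +_; _+_; _≤_)
open import Data.Fin using (Fin)
open import Data.Fin.Subset using (Subset; _∈_; _⊆_; ∣_∣)
open import Relation.Binary.PropositionalEquality using (_≡_)
import Data.Fin
import Data.Nat
import Data.Product

open import Data.Fin using (zero; suc)
open import Data.Fin.Properties using (_<?_; _≟_; <-cmp)
open import Data.Fin.Subset using (Side; inside; outside)
open import Data.Fin.Subset.Properties using (nonempty?)
open import Data.Integer as ℤ using (-_; _-_; _*_; +[1+_]; -[1+_]; +≤+; -≤+)
import Data.Integer.Properties as ℤ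
open import Data.Integer.Tactic.RingSolver using (solve-∀)
open import Data.List using (foldr; tabulate)
open import Data.List.Properties using (map-tabulate)
open import Data.Nat as ℕ using (zero; suc; z≤n)
import Data.Nat.Properties as ℕ
open import Data.Nat.Tactic.RingSolver using () renaming (solve-∀ to ℕ-solve-∀)
open import Data.Product using (Σ; _,_; proj₁; proj₂)
open import Data.Vec using ([]; _∷_; lookup)
open import Data.Vec.Properties using (lookup⇒[]=; []=⇒lookup)
open import Function using (_∘_; id)
open import Relation.Binary.Definitions using (tri<; tri≈; tri>)
open import Relation.Binary.PropositionalEquality
  using (refl; sym; trans; cong; cong₂; subst; subst₂; module ≡-Reasoning)
open import Relation.Nullary using (Dec; yes; no; ¬_; contradiction)
open import Relation.Nullary.Decidable using (map′)

open import Algebra.Properties.Semiring.Sum ℤ.+-*-semiring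
  using (sum; ∑-distrib-+; ∑-comm; *-distribˡ-sum; *-distribʳ-sum; sum-cong-≗; sum-replicate-zero)
open import Algebra.Properties.AbelianGroup ℤ.+-0-abelianGroup using (identityˡ-unique)

Σℤ≡sum : ∀ {n} (f : Fin n → ℤ) → Σℤ f ≡ sum f
Σℤ≡sum f = trans (cong (foldr _+_ (+ 0)) (map-tabulate id f)) (foldr-tabulate f)
  where
  foldr-tabulate : ∀ {m} (g : Fin m → ℤ) → foldr _+_ (+ 0) (tabulate g) ≡ sum g
  foldr-tabulate {zero}  g = refl
  foldr-tabulate {suc m} g = cong (_+_ (g zero)) (foldr-tabulate (g ∘ suc))

sum-mono-≤ : ∀ {n} {f g : Fin n → ℤ} → (∀ i → f i ≤ g i) → sum f ≤ sum g
sum-mono-≤ {zero}  _   = ℤ.≤-refl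
sum-mono-≤ {suc n} f≤g = ℤ.+-mono-≤ (f≤g zero) (sum-mono-≤ (f≤g ∘ suc))

sum-neg : ∀ {n} (f : Fin n → ℤ) → sum (λ i → - f i) ≡ - sum f
sum-neg {zero}  f = refl
sum-neg {suc n} f = trans (cong (_+_ (- f zero)) (sum-neg (f ∘ suc))) (sym (ℤ.neg-distrib-+ (f zero) _))

when : ∀ {p} {P : Set p} → Dec P → ℤ → ℤ
when (yes _) v = v
when (no _)  v = + 0

when-yes : ∀ {p} {P : Set p} (P? : Dec P) {v} → P → when P? v ≡ v
when-yes (yes _) _ = refl
when-yes (no ¬p) p = contradiction p ¬p

when-no : ∀ {p} {P : Set p} (P? : Dec P) {v} → ¬ P → when P? v ≡ + 0
when-no (yes p) ¬p = contradiction p ¬p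
when-no (no _)  _  = refl

when-map′ : ∀ {p q} {P : Set p} {Q : Set q} (P? : Dec P) {f : P → Q} {g : Q → P} {v} →
            when (map′ f g P?) v ≡ when P? v
when-map′ (yes _) = refl
when-map′ (no _)  = refl

sum-when-≟ : ∀ {n} (i : Fin n) (v : Fin n → ℤ) → sum (λ j → when (i ≟ j) (v j)) ≡ v i
sum-when-≟ {suc n} zero    v = trans (cong (_+_ (v zero)) (sum-replicate-zero n)) (ℤ.+-identityʳ (v zero))
sum-when-≟ {suc n} (suc i) v = begin
  + 0 + sum (λ j → when (suc i ≟ suc j) (v (suc j)))  ≡⟨ ℤ.+-identityˡ _ ⟩
  sum (λ j → when (suc i ≟ suc j) (v (suc j)))        ≡⟨ sum-cong-≗ (λ j → when-map′ (i ≟ j)) ⟩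
  sum (λ j → when (i ≟ j) (v (suc j)))                ≡⟨ sum-when-≟ i (v ∘ suc) ⟩
  v (suc i)                                           ∎
  where open ≡-Reasoning

when-trichotomy : ∀ {n} (i j : Fin n) v → v ≡ when (i <? j) v + when (j <? i) v + when (i ≟ j) v
when-trichotomy i j v with <-cmp i j
... | tri< i<j i≢j i≯j
  rewrite when-yes (i <? j) {v} i<j | when-no (j <? i) {v} i≯j | when-no (i ≟ j) {v} i≢j
  = sym (trans (ℤ.+-identityʳ _) (ℤ.+-identityʳ v))
... | tri≈ i≮j i≡j i≯j
  rewrite when-no (i <? j) {v} i≮j | when-no (j <? i) {v} i≯j | when-yes (i ≟ j) {v} i≡j
  = sym (ℤ.+-identityˡ v)
... | tri> i≮j i≢j i>j
  rewrite when-no (i <? j) {v} i≮j | when-yes (j <? i) {v} i>j | when-no (i ≟ j) {v} i≢j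
  = sym (trans (ℤ.+-identityʳ _) (ℤ.+-identityˡ v))

∑∑ : ∀ {m n} → (Fin m → Fin n → ℤ) → ℤ
∑∑ f = sum (λ i → sum (f i))

∑∑-cong : ∀ {m n} {f g : Fin m → Fin n → ℤ} → (∀ i j → f i j ≡ g i j) → ∑∑ f ≡ ∑∑ g
∑∑-cong f≡g = sum-cong-≗ (λ i → sum-cong-≗ (f≡g i))

∑∑-distrib-+ : ∀ {m n} (f g : Fin m → Fin n → ℤ) → ∑∑ (λ i j → f i j + g i j) ≡ ∑∑ f + ∑∑ g
∑∑-distrib-+ f g =
  trans (sum-cong-≗ λ i → ∑-distrib-+ (f i) (g i)) (∑-distrib-+ (λ i → sum (f i)) (λ i → sum (g i)))

∑∑-mono-≤ : ∀ {m n} {f g : Fin m → Fin n → ℤ} → (∀ i j → f i j ≤ g i j) → ∑∑ f ≤ ∑∑ g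
∑∑-mono-≤ f≤g = sum-mono-≤ (λ i → sum-mono-≤ (f≤g i))

∑∑-product : ∀ {m n} (f : Fin m → ℤ) (g : Fin n → ℤ) → ∑∑ (λ i j → f i * g j) ≡ sum f * sum g
∑∑-product f g = sym (trans (*-distribʳ-sum (sum g) f) (sum-cong-≗ λ i → *-distribˡ-sum (f i) g))

-- `Defs` keeps the summand of `Σpairs` in a `where` block; unification names it here.
private
  Σpairs-unfolded : ∀ {n} (f : Fin n → Fin n → ℤ) →
                    Σ (Fin n → Fin n → ℤ) λ g → Σpairs f ≡ Σℤ (λ i → Σℤ (g i))
  Σpairs-unfolded f = _ , refl

  pair-summand : ∀ {n} → (Fin n → Fin n → ℤ) → Fin n → Fin n → ℤ
  pair-summand f = proj₁ (Σpairs-unfolded f)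

  pair-summand≡when : ∀ {n} (f : Fin n → Fin n → ℤ) i j → pair-summand f i j ≡ when (i <? j) (f i j)
  pair-summand≡when f i j with i <? j
  ... | yes _ = refl
  ... | no  _ = refl

Σpairs≡∑∑ : ∀ {n} (f : Fin n → Fin n → ℤ) → Σpairs f ≡ ∑∑ (λ i j → when (i <? j) (f i j))
Σpairs≡∑∑ f = begin
  Σℤ (λ i → Σℤ (pair-summand f i))     ≡⟨ Σℤ≡sum (λ i → Σℤ (pair-summand f i)) ⟩
  sum (λ i → Σℤ (pair-summand f i))    ≡⟨ sum-cong-≗ (λ i → Σℤ≡sum (pair-summand f i)) ⟩
  ∑∑ (pair-summand f)                  ≡⟨ ∑∑-cong (pair-summand≡when f) ⟩
  ∑∑ (λ i j → when (i <? j) (f i j))   ∎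
  where open ≡-Reasoning

Σpairs-+ : ∀ {n} (f g : Fin n → Fin n → ℤ) → Σpairs (λ i j → f i j + g i j) ≡ Σpairs f + Σpairs g
Σpairs-+ f g = begin
  Σpairs (λ i j → f i j + g i j)              ≡⟨ Σpairs≡∑∑ (λ i j → f i j + g i j) ⟩
  ∑∑ (λ i j → when (i <? j) (f i j + g i j))  ≡⟨ ∑∑-cong (λ i j → when-+ (i <? j) (f i j) (g i j)) ⟩
  ∑∑ (λ i j → f< i j + g< i j)                ≡⟨ ∑∑-distrib-+ f< g< ⟩
  ∑∑ f< + ∑∑ g<                               ≡⟨ sym (cong₂ _+_ (Σpairs≡∑∑ f) (Σpairs≡∑∑ g)) ⟩
  Σpairs f + Σpairs g                         ∎
  where
  open ≡-Reasoning
  f< g< : Fin _ → Fin _ → ℤ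
  f< i j = when (i <? j) (f i j)
  g< i j = when (i <? j) (g i j)
  when-+ : ∀ {p} {P : Set p} (P? : Dec P) a b → when P? (a + b) ≡ when P? a + when P? b
  when-+ (yes _) _ _ = refl
  when-+ (no _)  _ _ = refl

Σpairs-mono-≤ : ∀ {n} {f g : Fin n → Fin n → ℤ} → (∀ i j → f i j ≤ g i j) → Σpairs f ≤ Σpairs g
Σpairs-mono-≤ {f = f} {g} f≤g = subst₂ _≤_ (sym (Σpairs≡∑∑ f)) (sym (Σpairs≡∑∑ g))
  (∑∑-mono-≤ λ i j → when-mono-≤ (i <? j) (f≤g i j))
  where
  when-mono-≤ : ∀ {p} {P : Set p} (P? : Dec P) {a b} → a ≤ b → when P? a ≤ when P? b
  when-mono-≤ (yes _) a≤b = a≤b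
  when-mono-≤ (no _)  _   = ℤ.≤-refl

Σpairs-symmetric : ∀ {n} (f : Fin n → Fin n → ℤ) → (∀ i j → f i j ≡ f j i) →
                   Σpairs f + Σpairs f + sum (λ i → f i i) ≡ ∑∑ f
Σpairs-symmetric f f-sym = sym (begin
  ∑∑ f                                   ≡⟨ ∑∑-cong (λ i j → when-trichotomy i j (f i j)) ⟩
  ∑∑ (λ i j → below i j + above i j + diagonal i j)
    ≡⟨ trans (∑∑-distrib-+ (λ i j → below i j + above i j) diagonal)
             (cong (_+ ∑∑ diagonal) (∑∑-distrib-+ below above)) ⟩
  ∑∑ below + ∑∑ above + ∑∑ diagonal
    ≡⟨ cong₂ (λ a b → a + b + ∑∑ diagonal) (sym (Σpairs≡∑∑ f)) above≡below ⟩
  Σpairs f + ∑∑ below + ∑∑ diagonal     ≡⟨ cong₂ (λ a b → Σpairs f + a + b) (sym (Σpairs≡∑∑ f))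
                                                (sum-cong-≗ λ i → sum-when-≟ i (f i)) ⟩
  Σpairs f + Σpairs f + sum (λ i → f i i) ∎)
  where
  open ≡-Reasoning
  below above diagonal : Fin _ → Fin _ → ℤ
  below    i j = when (i <? j) (f i j)
  above    i j = when (j <? i) (f i j)
  diagonal i j = when (i ≟ j) (f i j)
  above≡below : ∑∑ above ≡ ∑∑ below
  above≡below = trans (∑-comm above) (∑∑-cong λ i j → cong (when (i <? j)) (f-sym j i))

sgn : ℤ → ℤ
sgn (+ zero)   = + 0
sgn +[1+ _ ]   = + 1
sgn -[1+ _ ]   = - + 1

sgn-*-self : ∀ a → sgn a * a ≡ + ℤ.∣ a ∣
sgn-*-self (+ zero)   = refl
sgn-*-self +[1+ m ]   = ℤ.*-identityˡ +[1+ m ]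
sgn-*-self -[1+ m ]   = ℤ.-1*i≡-i -[1+ m ]

i≤+∣i∣ : ∀ i → i ≤ + ℤ.∣ i ∣
i≤+∣i∣ (+ _)    = ℤ.≤-refl
i≤+∣i∣ -[1+ _ ] = -≤+

sgn-*-≤-∣∣ : ∀ a b → sgn a * b ≤ + ℤ.∣ b ∣
sgn-*-≤-∣∣ (+ zero) b rewrite ℤ.*-zeroˡ b = +≤+ z≤n
sgn-*-≤-∣∣ +[1+ _ ] b rewrite ℤ.*-identityˡ b = i≤+∣i∣ b
sgn-*-≤-∣∣ -[1+ _ ] b rewrite ℤ.-1*i≡-i b = subst (λ k → - b ≤ + k) (ℤ.∣-i∣≡∣i∣ b) (i≤+∣i∣ (- b))

sgn-neg : ∀ a → sgn (- a) ≡ - sgn a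
sgn-neg (+ zero) = refl
sgn-neg +[1+ _ ] = refl
sgn-neg -[1+ _ ] = refl

∣∣-subgradient : ∀ w {u} d {h} → sgn w * u ≡ + ℤ.∣ u ∣ → h ≡ sgn w * d → + ℤ.∣ u ∣ + h ≤ + ℤ.∣ u + d ∣
∣∣-subgradient w {u} d {h} w∼u h≡ = subst (_≤ + ℤ.∣ u + d ∣) split (sgn-*-≤-∣∣ w (u + d))
  where
  split : sgn w * (u + d) ≡ + ℤ.∣ u ∣ + h
  split = trans (ℤ.*-distribˡ-+ (sgn w) u d) (cong₂ _+_ w∼u (sym h≡))

data Move : Set where
  up down stay : Move

δ : Move → ℤ
δ up   = + 1
δ down = - + 1
δ stay = + 0

χ : Move → ℤ
χ up   = + 1
χ down = + 1
χ stay = + 0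

data Admissible (c : ℤ) : ℤ → Move → Set where
  up   : Admissible c c up
  down : Admissible c c down
  stay : ∀ {a} → Admissible c a stay

δ*δ≡χ : ∀ μ → δ μ * δ μ ≡ χ μ
δ*δ≡χ up   = refl
δ*δ≡χ down = refl
δ*δ≡χ stay = refl

admissible-*δ : ∀ {c a μ} → Admissible c a μ → a * δ μ ≡ c * δ μ
admissible-*δ up                 = refl
admissible-*δ down               = refl
admissible-*δ {c} {a} stay = trans (ℤ.*-zeroʳ a) (sym (ℤ.*-zeroʳ c))

square-after-move : ∀ {c a μ} → Admissible c a μ → (a + δ μ) * (a + δ μ) ≡ a * a + + 2 * c * δ μ + χ μ
square-after-move {c} {a} {μ} adm = begin
  (a + δ μ) * (a + δ μ)                   ≡⟨ binomial a (δ μ) ⟩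
  a * a + + 2 * (a * δ μ) + δ μ * δ μ
    ≡⟨ cong₂ (λ s t → a * a + + 2 * s + t) (admissible-*δ adm) (δ*δ≡χ μ) ⟩
  a * a + + 2 * (c * δ μ) + χ μ
    ≡⟨ cong (λ s → a * a + s + χ μ) (sym (ℤ.*-assoc (+ 2) c (δ μ))) ⟩
  a * a + + 2 * c * δ μ + χ μ             ∎
  where
  open ≡-Reasoning
  binomial : ∀ a d → (a + d) * (a + d) ≡ a * a + + 2 * (a * d) + d * d
  binomial = solve-∀

abs-after-move : ∀ {c a μ} → Admissible c a μ → + ℤ.∣ a ∣ + sgn c * δ μ ≤ + ℤ.∣ a + δ μ ∣
abs-after-move {c} up   = ∣∣-subgradient c (+ 1) (sgn-*-self c) refl
abs-after-move {c} down = ∣∣-subgradient c (- + 1) (sgn-*-self c) refl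
abs-after-move {c} {a} stay =
  ∣∣-subgradient a (+ 0) (sgn-*-self a) (trans (ℤ.*-zeroʳ (sgn c)) (sym (ℤ.*-zeroʳ (sgn a))))

-- χχ' - δδ' - σδ' - δσ', written as a sum of products of a factor depending on (a , μ) and
-- one depending on (b , ν), so that its double sum factors into single sums.
gain : ℤ → ℤ → Move → ℤ → Move → ℤ
gain c a μ b ν = χ μ * χ ν + (- (δ μ + sgn (a - c))) * δ ν + (- δ μ) * sgn (b - c)

gain-sym : ∀ c a μ b ν → gain c a μ b ν ≡ gain c b ν a μ
gain-sym c a μ b ν = swap (χ μ) (χ ν) (δ μ) (δ ν) (sgn (a - c)) (sgn (b - c))
  where
  swap : ∀ χa χb δa δb σa σb →
         χa * χb + (- (δa + σa)) * δb + (- δa) * σb ≡ χb * χa + (- (δb + σb)) * δa + (- δb) * σa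
  swap = solve-∀

gain-diagonal : ∀ {c a μ} → Admissible c a μ → gain c a μ a μ ≡ + 0
gain-diagonal {c} up   rewrite ℤ.+-inverseʳ c = refl
gain-diagonal {c} down rewrite ℤ.+-inverseʳ c = refl
gain-diagonal {c} {a} stay = vanish (sgn (a - c))
  where
  vanish : ∀ σ → + 0 * + 0 + (- (+ 0 + σ)) * + 0 + (- + 0) * σ ≡ + 0
  vanish = solve-∀

distance-after-moves : ∀ {c a μ b ν} → Admissible c a μ → Admissible c b ν →
                       + ℤ.∣ a - b ∣ + gain c a μ b ν ≤ + ℤ.∣ (a + δ μ) - (b + δ ν) ∣
distance-after-moves {c} {a} {μ} {b} {ν} adm-a adm-b =
  subst (λ t → + ℤ.∣ a - b ∣ + gain c a μ b ν ≤ + ℤ.∣ t ∣) (sym (regroup a (δ μ) b (δ ν))) (go adm-a adm-b)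
  where
  regroup : ∀ a d b e → (a + d) - (b + e) ≡ (a - b) + (d - e)
  regroup = solve-∀

  moved-to-stay : ∀ μ {b} → + ℤ.∣ c - b ∣ + gain c c μ b stay ≤ + ℤ.∣ (c - b) + (δ μ - + 0) ∣
  moved-to-stay μ {b} = ∣∣-subgradient (c - b) (δ μ - + 0) (sgn-*-self (c - b)) (begin
    gain c c μ b stay                      ≡⟨ ring (χ μ) (δ μ) (sgn (c - c)) (sgn (b - c)) ⟩
    (- sgn (b - c)) * (δ μ - + 0)
      ≡⟨ cong (_* (δ μ - + 0)) (sym (trans (cong sgn (flip c b)) (sgn-neg (b - c)))) ⟩
    sgn (c - b) * (δ μ - + 0)               ∎)
    where
    open ≡-Reasoning
    ring : ∀ χa δa σa σb → χa * + 0 + (- (δa + σa)) * + 0 + (- δa) * σb ≡ (- σb) * (δa - + 0)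
    ring = solve-∀
    flip : ∀ c b → c - b ≡ - (b - c)
    flip = solve-∀

  stay-to-moved : ∀ ν {a} → + ℤ.∣ a - c ∣ + gain c a stay c ν ≤ + ℤ.∣ (a - c) + (+ 0 - δ ν) ∣
  stay-to-moved ν {a} = ∣∣-subgradient (a - c) (+ 0 - δ ν) (sgn-*-self (a - c))
    (ring (χ ν) (δ ν) (sgn (a - c)) (sgn (c - c)))
    where
    ring : ∀ χb δb σa σb → + 0 * χb + (- (+ 0 + σa)) * δb + (- + 0) * σb ≡ σa * (+ 0 - δb)
    ring = solve-∀

  go : ∀ {a μ b ν} → Admissible c a μ → Admissible c b ν →
       + ℤ.∣ a - b ∣ + gain c a μ b ν ≤ + ℤ.∣ (a - b) + (δ μ - δ ν) ∣
  go up   up   rewrite ℤ.+-inverseʳ c = ℤ.≤-refl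
  go up   down rewrite ℤ.+-inverseʳ c = ℤ.≤-refl
  go down up   rewrite ℤ.+-inverseʳ c = ℤ.≤-refl
  go down down rewrite ℤ.+-inverseʳ c = ℤ.≤-refl
  go         up   stay = moved-to-stay up
  go         down stay = moved-to-stay down
  go {a = a} stay up   = stay-to-moved up {a}
  go {a = a} stay down = stay-to-moved down {a}
  go {a} {b = b} stay stay = ∣∣-subgradient (a - b) (+ 0 - + 0) (sgn-*-self (a - b))
    (ring (sgn (a - c)) (sgn (b - c)) (sgn (a - b)))
    where
    ring : ∀ σa σb s → + 0 * + 0 + (- (+ 0 + σa)) * + 0 + (- + 0) * σb ≡ s * (+ 0 - + 0)
    ring = solve-∀

+-double-injective : ∀ a b → a + a ≡ b + b → a ≡ b
+-double-injective a b eq = ℤ.*-cancelˡ-≡ (+ 2) a b (trans (sym (doubling a)) (trans eq (doubling b)))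
  where
  doubling : ∀ a → a + a ≡ + 2 * a
  doubling = solve-∀

module Displacement {n} {c : ℤ} (x y : Fin n → ℤ) (m : Fin n → Move)
  (admissible : ∀ i → Admissible c (x i) (m i)) (displaced : ∀ i → y i ≡ x i + δ (m i))
  {q : ℕ} (moved : sum (χ ∘ m) ≡ + (2 ℕ.* q)) (balanced : sum (δ ∘ m) ≡ + 0) where

  sum-weighted-δ : ∀ k → sum (λ i → k * δ (m i)) ≡ + 0
  sum-weighted-δ k = trans (sym (*-distribˡ-sum k (δ ∘ m))) (trans (cong (k *_) balanced) (ℤ.*-zeroʳ k))

  Φ-displaced : Φ y ≡ Φ x + + (2 ℕ.* q)
  Φ-displaced = begin
    Φ y                                    ≡⟨ Σℤ≡sum (λ i → y i * y i) ⟩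
    sum (λ i → y i * y i)                  ≡⟨ sum-cong-≗ squares ⟩
    sum (λ i → x² i + linear i + χ (m i))  ≡⟨ ∑-distrib-+ (λ i → x² i + linear i) (χ ∘ m) ⟩
    sum (λ i → x² i + linear i) + sum (χ ∘ m)
      ≡⟨ cong₂ _+_ (∑-distrib-+ x² linear) moved ⟩
    sum x² + sum linear + + (2 ℕ.* q)
      ≡⟨ cong (λ t → sum x² + t + + (2 ℕ.* q)) (sum-weighted-δ (+ 2 * c)) ⟩
    sum x² + + 0 + + (2 ℕ.* q)
      ≡⟨ cong (_+ + (2 ℕ.* q)) (trans (ℤ.+-identityʳ (sum x²)) (sym (Σℤ≡sum x²))) ⟩
    Φ x + + (2 ℕ.* q)                      ∎
    where
    open ≡-Reasoning
    x² linear : Fin n → ℤ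
    x² i     = x i * x i
    linear i = + 2 * c * δ (m i)
    squares : ∀ i → y i * y i ≡ x² i + linear i + χ (m i)
    squares i rewrite displaced i = square-after-move (admissible i)

  σ : Fin n → ℤ
  σ i = sgn (x i - c)

  gains : Fin n → Fin n → ℤ
  gains i j = gain c (x i) (m i) (x j) (m j)

  ∑∑-gains : ∑∑ gains ≡ + (2 ℕ.* q) * + (2 ℕ.* q)
  ∑∑-gains = begin
    ∑∑ gains
      ≡⟨ trans (∑∑-distrib-+ (λ i j → χχ i j + Aδ i j) δσ) (cong (_+ ∑∑ δσ) (∑∑-distrib-+ χχ Aδ)) ⟩
    ∑∑ χχ + ∑∑ Aδ + ∑∑ δσ
      ≡⟨ cong₂ _+_ (cong₂ _+_ (∑∑-product (χ ∘ m) (χ ∘ m)) (∑∑-product A (δ ∘ m)))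
                   (trans (∑∑-product (λ i → - δ (m i)) σ) (cong (_* sum σ) (sum-neg (δ ∘ m)))) ⟩
    sum (χ ∘ m) * sum (χ ∘ m) + sum A * sum (δ ∘ m) + (- sum (δ ∘ m)) * sum σ
      ≡⟨ cong₂ (λ s t → s * s + sum A * t + (- t) * sum σ) moved balanced ⟩
    + (2 ℕ.* q) * + (2 ℕ.* q) + sum A * + 0 + (- + 0) * sum σ
      ≡⟨ drop-zeros (+ (2 ℕ.* q) * + (2 ℕ.* q)) (sum A) (sum σ) ⟩
    + (2 ℕ.* q) * + (2 ℕ.* q) ∎
    where
    open ≡-Reasoning
    A : Fin n → ℤ
    A i = - (δ (m i) + σ i)
    χχ Aδ δσ : Fin n → Fin n → ℤ
    χχ i j = χ (m i) * χ (m j)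
    Aδ i j = A i * δ (m j)
    δσ i j = (- δ (m i)) * σ j
    drop-zeros : ∀ a s t → a + s * + 0 + (- + 0) * t ≡ a
    drop-zeros = solve-∀

  Σpairs-gains : Σpairs gains ≡ + (2 ℕ.* (q ℕ.* q))
  Σpairs-gains = +-double-injective (Σpairs gains) (+ (2 ℕ.* (q ℕ.* q))) (begin
    Σpairs gains + Σpairs gains                       ≡⟨ sym (ℤ.+-identityʳ _) ⟩
    Σpairs gains + Σpairs gains + + 0
      ≡⟨ cong (_+_ (Σpairs gains + Σpairs gains)) (sym diagonal) ⟩
    Σpairs gains + Σpairs gains + sum (λ i → gains i i)
      ≡⟨ Σpairs-symmetric gains (λ i j → gain-sym c (x i) (m i) (x j) (m j)) ⟩
    ∑∑ gains                                          ≡⟨ ∑∑-gains ⟩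
    + (2 ℕ.* q) * + (2 ℕ.* q)                         ≡⟨ sym (ℤ.pos-* (2 ℕ.* q) (2 ℕ.* q)) ⟩
    + ((2 ℕ.* q) ℕ.* (2 ℕ.* q))                       ≡⟨ cong +_ (four-squares q) ⟩
    + (2 ℕ.* (q ℕ.* q) ℕ.+ 2 ℕ.* (q ℕ.* q))           ≡⟨ ℤ.pos-+ (2 ℕ.* (q ℕ.* q)) (2 ℕ.* (q ℕ.* q)) ⟩
    + (2 ℕ.* (q ℕ.* q)) + + (2 ℕ.* (q ℕ.* q))         ∎)
    where
    open ≡-Reasoning
    diagonal : sum (λ i → gains i i) ≡ + 0
    diagonal = trans (sum-cong-≗ (gain-diagonal ∘ admissible)) (sum-replicate-zero n)
    four-squares : ∀ q → (2 ℕ.* q) ℕ.* (2 ℕ.* q) ≡ 2 ℕ.* (q ℕ.* q) ℕ.+ 2 ℕ.* (q ℕ.* q)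
    four-squares = ℕ-solve-∀

  Σabs-displaced : Σℤ (λ i → + ℤ.∣ x i ∣) ≤ Σℤ (λ i → + ℤ.∣ y i ∣)
  Σabs-displaced = subst₂ _≤_ (trans vanish (sym (Σℤ≡sum ∣x∣))) (sym (Σℤ≡sum (λ i → + ℤ.∣ y i ∣)))
    (sum-mono-≤ step)
    where
    ∣x∣ : Fin n → ℤ
    ∣x∣ i = + ℤ.∣ x i ∣
    step : ∀ i → ∣x∣ i + sgn c * δ (m i) ≤ + ℤ.∣ y i ∣
    step i rewrite displaced i = abs-after-move (admissible i)
    vanish : sum (λ i → ∣x∣ i + sgn c * δ (m i)) ≡ sum ∣x∣
    vanish = trans (∑-distrib-+ ∣x∣ (λ i → sgn c * δ (m i)))
                   (trans (cong (_+_ (sum ∣x∣)) (sum-weighted-δ (sgn c))) (ℤ.+-identityʳ (sum ∣x∣)))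

  Ψ-displaced : Ψ x + + (2 ℕ.* (q ℕ.* q)) ≤ Ψ y
  Ψ-displaced = begin
    N + Σpairs dist + + (2 ℕ.* (q ℕ.* q))      ≡⟨ ℤ.+-assoc N (Σpairs dist) (+ (2 ℕ.* (q ℕ.* q))) ⟩
    N + (Σpairs dist + + (2 ℕ.* (q ℕ.* q)))    ≡⟨ cong (λ t → N + (Σpairs dist + t)) (sym Σpairs-gains) ⟩
    N + (Σpairs dist + Σpairs gains)           ≡⟨ cong (_+_ N) (sym (Σpairs-+ dist gains)) ⟩
    N + Σpairs (λ i j → dist i j + gains i j)
      ≤⟨ ℤ.+-mono-≤ (ℤ.*-monoˡ-≤-nonNeg (+ n) Σabs-displaced) (Σpairs-mono-≤ step) ⟩
    Ψ y                                        ∎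
    where
    open ℤ.≤-Reasoning
    N : ℤ
    N = + n * Σℤ (λ i → + ℤ.∣ x i ∣)
    dist : Fin n → Fin n → ℤ
    dist i j = + ℤ.∣ x i - x j ∣
    step : ∀ i j → dist i j + gains i j ≤ + ℤ.∣ y i - y j ∣
    step i j rewrite displaced i | displaced j = distance-after-moves (admissible i) (admissible j)

move : Side → Side → Move
move inside  inside  = up
move inside  outside = down
move outside _       = stay

moves : ∀ {n} → Subset n → Subset n → Fin n → Move
moves S P i = move (lookup S i) (lookup P i)

indicator : Side → ℤ
indicator inside  = + 1
indicator outside = + 0

sum-indicator : ∀ {n} (S : Subset n) → sum (indicator ∘ lookup S) ≡ + ∣ S ∣
sum-indicator []            = refl
sum-indicator (inside ∷ S)  = cong (_+_ (+ 1)) (sum-indicator S)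
sum-indicator (outside ∷ S) = trans (ℤ.+-identityˡ _) (sum-indicator S)

χ-move : ∀ s p → χ (move s p) ≡ indicator s
χ-move inside  inside  = refl
χ-move inside  outside = refl
χ-move outside _       = refl

δ-move : ∀ s p → (p ≡ inside → s ≡ inside) → δ (move s p) + indicator s ≡ indicator p + indicator p
δ-move inside  inside  _ = refl
δ-move inside  outside _ = refl
δ-move outside inside  p⇒s with () ← p⇒s refl
δ-move outside outside _ = refl

sum-χ-moves : ∀ {n} (S P : Subset n) → sum (χ ∘ moves S P) ≡ + ∣ S ∣
sum-χ-moves S P = trans (sum-cong-≗ (λ i → χ-move (lookup S i) (lookup P i))) (sum-indicator S)

sum-δ-moves : ∀ {n} (S P : Subset n) → P ⊆ S → sum (δ ∘ moves S P) + + ∣ S ∣ ≡ + ∣ P ∣ + + ∣ P ∣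
sum-δ-moves S P P⊆S = begin
  sum (δ ∘ moves S P) + + ∣ S ∣
    ≡⟨ cong (_+_ (sum (δ ∘ moves S P))) (sym (sum-indicator S)) ⟩
  sum (δ ∘ moves S P) + sum (indicator ∘ lookup S)
    ≡⟨ sym (∑-distrib-+ (δ ∘ moves S P) (indicator ∘ lookup S)) ⟩
  sum (λ i → δ (moves S P i) + indicator (lookup S i))
    ≡⟨ sum-cong-≗ (λ i → δ-move (lookup S i) (lookup P i) (inside-P⇒inside-S i)) ⟩
  sum (λ i → indicator (lookup P i) + indicator (lookup P i))
    ≡⟨ ∑-distrib-+ (indicator ∘ lookup P) (indicator ∘ lookup P) ⟩
  sum (indicator ∘ lookup P) + sum (indicator ∘ lookup P)
    ≡⟨ cong₂ _+_ (sum-indicator P) (sum-indicator P) ⟩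
  + ∣ P ∣ + + ∣ P ∣                             ∎
  where
  open ≡-Reasoning
  inside-P⇒inside-S : ∀ i → lookup P i ≡ inside → lookup S i ≡ inside
  inside-P⇒inside-S i i∈P = []=⇒lookup (P⊆S (lookup⇒[]= i P i∈P))

shift≡displacement : ∀ {n} (S P : Subset n) (x : Fin n → ℤ) i → shift S P x i ≡ x i + δ (moves S P i)
shift≡displacement S P x i with lookup S i | lookup P i
... | inside  | inside  = refl
... | inside  | outside = refl
... | outside | _       = sym (ℤ.+-identityʳ (x i))

admissible-moves : ∀ {n c} {x : Fin n → ℤ} (S P : Subset n) → (∀ i → i ∈ S → x i ≡ c) →
                   ∀ i → Admissible c (x i) (moves S P i)
admissible-moves S P level i with lookup S i in i∈S | lookup P i
... | inside  | inside  rewrite level i (lookup⇒[]= i S i∈S) = up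
... | inside  | outside rewrite level i (lookup⇒[]= i S i∈S) = down
... | outside | _       = stay

common-level : ∀ {n} (x : Fin n → ℤ) (S : Subset n) → (∀ i j → i ∈ S → j ∈ S → x i ≡ x j) →
               Σ ℤ λ c → ∀ i → i ∈ S → x i ≡ c
common-level x S equal with nonempty? S
... | yes (i₀ , i₀∈S) = x i₀ , λ i i∈S → equal i i₀ i∈S i₀∈S
... | no  S-empty     = + 0 , λ i i∈S → contradiction (i , i∈S) S-empty

proposition6p2 : (n q : ℕ) → q ≥ 1 → (x : Fin n → ℤ)
    → (∀ i j → i Data.Fin.≤ j → x j ≤ x i)
    → (S P : Subset n) → ∣ S ∣ ≡ 2 Data.Nat.* q
    → (∀ i j → i ∈ S → j ∈ S → x i ≡ x j)
    → P ⊆ S → ∣ P ∣ ≡ q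
    → (Φ (shift S P x) ≡ Φ x + + (2 Data.Nat.* q))
      Data.Product.× (Ψ x + + (2 Data.Nat.* (q Data.Nat.* q)) ≤ Ψ (shift S P x))
proposition6p2 n q _ x _ S P ∣S∣≡2q equal P⊆S ∣P∣≡q = Φ-displaced , Ψ-displaced
  where
  c : ℤ
  c = proj₁ (common-level x S equal)
  level : ∀ i → i ∈ S → x i ≡ c
  level = proj₂ (common-level x S equal)
  moved : sum (χ ∘ moves S P) ≡ + (2 ℕ.* q)
  moved = trans (sum-χ-moves S P) (cong +_ ∣S∣≡2q)
  ∣P∣+∣P∣≡∣S∣ : + ∣ P ∣ + + ∣ P ∣ ≡ + ∣ S ∣
  ∣P∣+∣P∣≡∣S∣ rewrite ∣P∣≡q | ∣S∣≡2q = cong (λ k → + (q ℕ.+ k)) (sym (ℕ.+-identityʳ q))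
  balanced : sum (δ ∘ moves S P) ≡ + 0
  balanced = identityˡ-unique _ (+ ∣ S ∣) (trans (sum-δ-moves S P P⊆S) ∣P∣+∣P∣≡∣S∣)
  open Displacement x (shift S P x) (moves S P) (admissible-moves S P level) (shift≡displacement S P x)
                    {q} moved balanced
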